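{- Let $G$ and $G'$ be graphs, and let $S\subseteq V(G)$, $S'\subseteq V(G')$ with $|S|=|S'|=:s$. Then $\mathcal{E}(G;S,q)=\mathcal{E}(G';S',q)$ (as polynomials in $q$) if and only if for each $0\leq k\leq s$, $$\sum_{W\in\binom{S}{k}}|\mathrm{Obs}(G;W)|=\sum_{W'\in\binom{S'}{k}}|\mathrm{Obs}(G';W')|.$$
   Context: Graphs are finite and simple; $N[X]$ is the closed neighborhood of $X$. Power domination process on a graph $H$ from $T\subseteq V(H)$: set $B:=N[T]$; then, while some $x\in B$ has exactly one vertex $y$ of $N[x]$ outside $B$, add $y$ to $B$. The final set is $\mathrm{Obs}(H;T)$ (with $\mathrm{Obs}(H;\emptyset)=\emptyset$). For $S\subseteq V(H)$, $\mathcal{E}(H;S,q)=\sum_{W\subseteq S}|\mathrm{Obs}(H;W)|\,q^{|S\setminus W|}(1-q)^{|W|}$ (expected number of observed vertices when each sensor fails independently with probability $q$). $\binom{S}{k}$ denotes the set of $k$-element subsets of $S$. -}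

module Defs where

open import Data.Bool using (Bool; true; false; _∨_)
open import Data.Nat using (ℕ; zero; suc; _∸_)
open import Data.Fin using (Fin; _≟_)
open import Data.Fin.Subset using (Subset; _∪_; _∩_; ∁; ⁅_⁆; ∣_∣; ⊥; inside; outside)
open import Data.Fin.Subset.Properties using (_∈?_; _⊆?_)
open import Data.List using (List; []; _∷_; _++_; filter; map; foldr; allFin)
open import Data.Maybe using (Maybe; just; nothing)
open import Data.Vec using (Vec; tabulate)
open import Data.Integer as ℤ using (ℤ; +_)
open import Relation.Binary.PropositionalEquality using (_≡_)
open import Relation.Nullary using (¬?; does)
import Data.Nat as ℕ

record Graph (n : ℕ) : Set where
  field
    adj    : Fin n → Fin n → Bool
    sym    : ∀ x y → adj x y ≡ adj y x
    irrefl : ∀ x → adj x x ≡ false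

module _ {n : ℕ} (G : Graph n) where
  open Graph G

  N[_] : Fin n → Subset n
  N[ x ] = tabulate (λ y → does (y ≟ x) ∨ adj x y)

  N[_]ˢ : Subset n → Subset n
  N[ T ]ˢ = foldr _∪_ ⊥ (map N[_] (filter (_∈? T) (allFin n)))

  outsideNbrs : Subset n → Fin n → List (Fin n)
  outsideNbrs B x = filter (λ y → ¬? (y ∈? B)) (filter (_∈? N[ x ]) (allFin n))

  forced : Subset n → Fin n → Maybe (Fin n)
  forced B x with does (x ∈? B) | outsideNbrs B x
  ... | true | y ∷ [] = just y
  ... | _    | _      = nothing

  firstJust : List (Maybe (Fin n)) → Maybe (Fin n)
  firstJust []              = nothing
  firstJust (just y  ∷ _ )  = just y
  firstJust (nothing ∷ ms)  = firstJust ms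

  step : Subset n → Subset n
  step B with firstJust (map (forced B) (allFin n))
  ... | just y  = B ∪ ⁅ y ⁆
  ... | nothing = B

  iterate : ℕ → Subset n → Subset n
  iterate zero    B = B
  iterate (suc k) B = iterate k (step B)

  -- Obs(G;T): start with N[T], apply the rule until it no longer applies.
  -- Every productive step adds a new vertex, so n steps suffice.
  Obs : Subset n → Subset n
  Obs T = iterate n N[ T ]ˢ

allSubsets : (n : ℕ) → List (Subset n)
allSubsets zero    = Vec.[] ∷ []
  where import Data.Vec as Vec
allSubsets (suc n) = map (outside Vec.∷_) (allSubsets n) ++ map (inside Vec.∷_) (allSubsets n)
  where import Data.Vec as Vec

subsetsOf : {n : ℕ} → Subset n → List (Subset n)
subsetsOf S = filter (_⊆? S) (allSubsets _)

kSubsetsOf : {n : ℕ} → Subset n → ℕ → List (Subset n)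
kSubsetsOf S k = filter (λ W → ∣ W ∣ ℕ.≟ k) (subsetsOf S)

-- Integer polynomials as coefficient lists (constant term first)

Poly : Set
Poly = List ℤ

coeff : Poly → ℕ → ℤ
coeff []       _       = + 0
coeff (a ∷ _)  zero    = a
coeff (_ ∷ p)  (suc j) = coeff p j

_+ₚ_ : Poly → Poly → Poly
[]      +ₚ q       = q
(a ∷ p) +ₚ []      = a ∷ p
(a ∷ p) +ₚ (b ∷ q) = (a ℤ.+ b) ∷ (p +ₚ q)

scaleₚ : ℤ → Poly → Poly
scaleₚ c = map (c ℤ.*_)

_*ₚ_ : Poly → Poly → Poly
[]      *ₚ q = []
(a ∷ p) *ₚ q = scaleₚ a q +ₚ (+ 0 ∷ (p *ₚ q))

oneₚ : Poly
oneₚ = + 1 ∷ []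

Xₚ : Poly
Xₚ = + 0 ∷ + 1 ∷ []

oneMinusXₚ : Poly
oneMinusXₚ = + 1 ∷ ℤ.- (+ 1) ∷ []

_^ₚ_ : Poly → ℕ → Poly
p ^ₚ zero  = oneₚ
p ^ₚ suc k = p *ₚ (p ^ₚ k)

sumₚ : List Poly → Poly
sumₚ = foldr _+ₚ_ []

_≈ₚ_ : Poly → Poly → Set
p ≈ₚ q = ∀ j → coeff p j ≡ coeff q j

𝓔 : {n : ℕ} → Graph n → Subset n → Poly
𝓔 G S = sumₚ (map term (subsetsOf S))
  where
  term : _ → Poly
  term W = scaleₚ (+ ∣ Obs G W ∣) ((Xₚ ^ₚ ∣ S ∩ ∁ W ∣) *ₚ (oneMinusXₚ ^ₚ ∣ W ∣))

obsSum : {n : ℕ} → Graph n → Subset n → ℕ → ℕ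
obsSum G S k = foldr (λ W acc → ∣ Obs G W ∣ ℕ.+ acc) 0 (kSubsetsOf S k)

-- Grouping the subsets W ⊆ S by their size k turns 𝓔(G;S,q) into
-- Σ_{k ≤ s} a_k q^(s-k) (1-q)^k, where a_k is the k-th observation sum.  The
-- lowest-order term of q^(s-k) (1-q)^k is q^(s-k) with coefficient 1, so these
-- s+1 polynomials are unitriangular with respect to the monomials and hence
-- linearly independent: 𝓔 determines the a_k and conversely.  Neither the graph
-- nor the propagation rule plays any role.

module Submission where

open import Defs
open import Data.Nat using (ℕ; _≤_)
open import Data.Fin.Subset using (Subset; ∣_∣)
open import Function.Bundles using (_⇔_)
open import Relation.Binary.PropositionalEquality using (_≡_)

import Data.Integer.Properties as ℤ
open import Algebra.Properties.CommutativeSemigroup ℤ.+-commutativeSemigroup using (interchange; x∙yz≈y∙xz)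
open import Algebra.Properties.Ring ℤ.+-*-ring using ([y-z]x≈yx-zx)
open import Data.Fin.Subset using (_⊆_; _∩_; ∁; inside; outside)
open import Data.Fin.Subset.Properties using (_⊆?_; drop-∷-⊆; p⊆q⇒∣p∣≤∣q∣)
open import Data.Integer using (ℤ; +_; 0ℤ; 1ℤ; _+_; _-_; _*_; -_)
open import Data.List using (List; []; _∷_; map; filter; foldr)
open import Data.List.Relation.Unary.All using (All; []; _∷_)
import Data.List.Relation.Unary.All as All
open import Data.List.Relation.Unary.All.Properties using (all-filter)
open import Data.Nat as ℕ using (zero; suc; _∸_; _<_; s≤s; z<s; s≤s⁻¹)
open import Data.Nat.Induction using (<-rec)
open import Data.Nat.Properties using (m<n⇒m<1+n; n<1+n; <⇒≢; ≤∧≢⇒<; ≮⇒≥; +-∸-assoc; ∸-cancelˡ-≡)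
open import Data.Vec using ([]; _∷_; here)
open import Function using (_∘_)
open import Function.Bundles using (mk⇔)
open import Relation.Binary.PropositionalEquality using (_≢_; refl; sym; trans; cong; cong₂; module ≡-Reasoning)
open import Relation.Nullary using (yes; no; contradiction)
open import Relation.Nullary.Decidable using (dec-true; dec-false)

open ≡-Reasoning

∑∈ : {A : Set} → List A → (A → ℤ) → ℤ
∑∈ []      f = 0ℤ
∑∈ (x ∷ L) f = f x + ∑∈ L f

infix 6.5 ∑∈ ∑<

syntax ∑∈ L (λ x → e) = ∑[ x ∈ L ] e

∑< : ℕ → (ℕ → ℤ) → ℤ
∑< zero    f = 0ℤ
∑< (suc N) f = ∑< N f + f N

syntax ∑< N (λ k → e) = ∑[ k < N ] e

∑∈-congᴬ : {A : Set} {P : A → Set} {f g : A → ℤ} {L : List A} →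
  (∀ {x} → P x → f x ≡ g x) → All P L → ∑∈ L f ≡ ∑∈ L g
∑∈-congᴬ f≗g []         = refl
∑∈-congᴬ f≗g (px ∷ pxs) = cong₂ _+_ (f≗g px) (∑∈-congᴬ f≗g pxs)

∑<-cong : ∀ N {f g : ℕ → ℤ} → (∀ {k} → k < N → f k ≡ g k) → ∑< N f ≡ ∑< N g
∑<-cong zero    f≗g = refl
∑<-cong (suc N) f≗g = cong₂ _+_ (∑<-cong N (f≗g ∘ m<n⇒m<1+n)) (f≗g (n<1+n N))

∑<-zero : ∀ N → ∑[ k < N ] 0ℤ ≡ 0ℤ
∑<-zero zero    = refl
∑<-zero (suc N) = cong (_+ 0ℤ) (∑<-zero N)

∑<-distrib-- : ∀ N (f g : ℕ → ℤ) → ∑[ k < N ] (f k - g k) ≡ ∑< N f - ∑< N g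
∑<-distrib-- zero    f g = refl
∑<-distrib-- (suc N) f g = begin
  ∑[ k < N ] (f k - g k) + (f N - g N)     ≡⟨ cong (_+ (f N - g N)) (∑<-distrib-- N f g) ⟩
  (∑< N f - ∑< N g) + (f N - g N)          ≡⟨ interchange (∑< N f) (- ∑< N g) (f N) (- g N) ⟩
  (∑< N f + f N) + (- ∑< N g + - g N)      ≡⟨ cong (_+_ (∑< N f + f N)) (sym (ℤ.neg-distrib-+ (∑< N g) (g N))) ⟩
  (∑< N f + f N) - (∑< N g + g N)          ∎

∑<-update : ∀ N {f g : ℕ → ℤ} {m c} → m < N →
  (∀ {k} → k < N → k ≢ m → f k ≡ g k) → f m ≡ c + g m → ∑< N f ≡ c + ∑< N g
∑<-update (suc N) {f} {g} {m} {c} m<1+N off at with m ℕ.≟ N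
... | yes refl = begin
  ∑< N f + f N         ≡⟨ cong₂ _+_ (∑<-cong N (λ k<N → off (m<n⇒m<1+n k<N) (<⇒≢ k<N))) at ⟩
  ∑< N g + (c + g N)   ≡⟨ x∙yz≈y∙xz (∑< N g) c (g N) ⟩
  c + (∑< N g + g N)   ∎
... | no m≢N = begin
  ∑< N f + f N         ≡⟨ cong₂ _+_ (∑<-update N {c = c} (≤∧≢⇒< (s≤s⁻¹ m<1+N) m≢N) (off ∘ m<n⇒m<1+n) at)
                                    (off (n<1+n N) (m≢N ∘ sym)) ⟩
  c + ∑< N g + g N     ≡⟨ ℤ.+-assoc c (∑< N g) (g N) ⟩
  c + (∑< N g + g N)   ∎

∑<-single : ∀ N {f : ℕ → ℤ} {m} → m < N → (∀ {k} → k < N → k ≢ m → f k ≡ 0ℤ) → ∑< N f ≡ f m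
∑<-single N {f} {m} m<N off = begin
  ∑< N f                ≡⟨ ∑<-update N {c = f m} m<N off (sym (ℤ.+-identityʳ (f m))) ⟩
  f m + ∑[ k < N ] 0ℤ   ≡⟨ cong (_+_ (f m)) (∑<-zero N) ⟩
  f m + 0ℤ              ≡⟨ ℤ.+-identityʳ (f m) ⟩
  f m                   ∎

coeff-+ₚ : ∀ p q j → coeff (p +ₚ q) j ≡ coeff p j + coeff q j
coeff-+ₚ []      q       j       = sym (ℤ.+-identityˡ (coeff q j))
coeff-+ₚ (a ∷ p) []      j       = sym (ℤ.+-identityʳ (coeff (a ∷ p) j))
coeff-+ₚ (a ∷ p) (b ∷ q) zero    = refl
coeff-+ₚ (a ∷ p) (b ∷ q) (suc j) = coeff-+ₚ p q j

coeff-scaleₚ : ∀ c p j → coeff (scaleₚ c p) j ≡ c * coeff p j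
coeff-scaleₚ c []      j       = sym (ℤ.*-zeroʳ c)
coeff-scaleₚ c (a ∷ p) zero    = refl
coeff-scaleₚ c (a ∷ p) (suc j) = coeff-scaleₚ c p j

coeff-sumₚ : {A : Set} (f : A → Poly) (L : List A) (j : ℕ) →
  coeff (sumₚ (map f L)) j ≡ ∑[ x ∈ L ] coeff (f x) j
coeff-sumₚ f []      j = refl
coeff-sumₚ f (x ∷ L) j =
  trans (coeff-+ₚ (f x) (sumₚ (map f L)) j) (cong (_+_ (coeff (f x) j)) (coeff-sumₚ f L j))

coeff-∷*ₚ-zero : ∀ a p q → coeff ((a ∷ p) *ₚ q) 0 ≡ a * coeff q 0
coeff-∷*ₚ-zero a p q =
  trans (coeff-+ₚ (scaleₚ a q) _ 0) (trans (ℤ.+-identityʳ _) (coeff-scaleₚ a q 0))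

coeff-∷*ₚ-suc : ∀ a p q j → coeff ((a ∷ p) *ₚ q) (suc j) ≡ a * coeff q (suc j) + coeff (p *ₚ q) j
coeff-∷*ₚ-suc a p q j =
  trans (coeff-+ₚ (scaleₚ a q) _ (suc j)) (cong (_+ coeff (p *ₚ q) j) (coeff-scaleₚ a q (suc j)))

VanishesBelow : ℕ → Poly → Set
VanishesBelow m p = ∀ {i} → i < m → coeff p i ≡ 0ℤ

*ₚ-vanishesBelow : ∀ {m} p q → VanishesBelow m p → VanishesBelow m (p *ₚ q)
*ₚ-vanishesBelow []      q p≈0 _ = refl
*ₚ-vanishesBelow (a ∷ p) q p≈0 {zero} 0<m =
  trans (coeff-∷*ₚ-zero a p q) (cong (_* coeff q 0) (p≈0 0<m))
*ₚ-vanishesBelow {suc m} (a ∷ p) q p≈0 {suc i} (s≤s i<m) = begin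
  coeff ((a ∷ p) *ₚ q) (suc i)             ≡⟨ coeff-∷*ₚ-suc a p q i ⟩
  a * coeff q (suc i) + coeff (p *ₚ q) i   ≡⟨ cong₂ (λ a r → a * coeff q (suc i) + r) (p≈0 z<s)
                                                    (*ₚ-vanishesBelow p q (p≈0 ∘ s≤s) i<m) ⟩
  0ℤ                                       ∎

coeff-*ₚ-lowest : ∀ {m} p q → VanishesBelow m p → coeff (p *ₚ q) m ≡ coeff p m * coeff q 0
coeff-*ₚ-lowest []      q p≈0 = refl
coeff-*ₚ-lowest {zero} (a ∷ p) q p≈0 = coeff-∷*ₚ-zero a p q
coeff-*ₚ-lowest {suc m} (a ∷ p) q p≈0 = begin
  coeff ((a ∷ p) *ₚ q) (suc m)             ≡⟨ coeff-∷*ₚ-suc a p q m ⟩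
  a * coeff q (suc m) + coeff (p *ₚ q) m   ≡⟨ cong (λ a → a * coeff q (suc m) + coeff (p *ₚ q) m) (p≈0 z<s) ⟩
  0ℤ + coeff (p *ₚ q) m                    ≡⟨ ℤ.+-identityˡ _ ⟩
  coeff (p *ₚ q) m                         ≡⟨ coeff-*ₚ-lowest p q (p≈0 ∘ s≤s) ⟩
  coeff p m * coeff q 0                    ∎

coeff-oneₚ*ₚ : ∀ p j → coeff (oneₚ *ₚ p) j ≡ coeff p j
coeff-oneₚ*ₚ p j = begin
  coeff (oneₚ *ₚ p) j                          ≡⟨ coeff-+ₚ (scaleₚ 1ℤ p) (0ℤ ∷ []) j ⟩
  coeff (scaleₚ 1ℤ p) j + coeff (0ℤ ∷ []) j    ≡⟨ cong₂ _+_ (coeff-scaleₚ 1ℤ p j) (coeff-0 j) ⟩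
  1ℤ * coeff p j + 0ℤ                          ≡⟨ ℤ.+-identityʳ _ ⟩
  1ℤ * coeff p j                               ≡⟨ ℤ.*-identityˡ _ ⟩
  coeff p j                                    ∎
  where
  coeff-0 : ∀ j → coeff (0ℤ ∷ []) j ≡ 0ℤ
  coeff-0 zero    = refl
  coeff-0 (suc j) = refl

coeff-Xₚ*ₚ-zero : ∀ p → coeff (Xₚ *ₚ p) 0 ≡ 0ℤ
coeff-Xₚ*ₚ-zero p = coeff-∷*ₚ-zero 0ℤ oneₚ p

coeff-Xₚ*ₚ-suc : ∀ p j → coeff (Xₚ *ₚ p) (suc j) ≡ coeff p j
coeff-Xₚ*ₚ-suc p j =
  trans (coeff-∷*ₚ-suc 0ℤ oneₚ p j) (trans (ℤ.+-identityˡ _) (coeff-oneₚ*ₚ p j))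

Xₚ^ₚ-vanishesBelow : ∀ m → VanishesBelow m (Xₚ ^ₚ m)
Xₚ^ₚ-vanishesBelow (suc m) {zero}  _         = coeff-Xₚ*ₚ-zero (Xₚ ^ₚ m)
Xₚ^ₚ-vanishesBelow (suc m) {suc i} (s≤s i<m) =
  trans (coeff-Xₚ*ₚ-suc (Xₚ ^ₚ m) i) (Xₚ^ₚ-vanishesBelow m i<m)

coeff-Xₚ^ₚ-self : ∀ m → coeff (Xₚ ^ₚ m) m ≡ 1ℤ
coeff-Xₚ^ₚ-self zero    = refl
coeff-Xₚ^ₚ-self (suc m) = trans (coeff-Xₚ*ₚ-suc (Xₚ ^ₚ m) m) (coeff-Xₚ^ₚ-self m)

coeff₀-oneMinusXₚ^ₚ : ∀ k → coeff (oneMinusXₚ ^ₚ k) 0 ≡ 1ℤ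
coeff₀-oneMinusXₚ^ₚ zero    = refl
coeff₀-oneMinusXₚ^ₚ (suc k) =
  trans (coeff-∷*ₚ-zero 1ℤ (- 1ℤ ∷ []) (oneMinusXₚ ^ₚ k)) (trans (ℤ.*-identityˡ _) (coeff₀-oneMinusXₚ^ₚ k))

bernsteinₚ : ℕ → ℕ → Poly
bernsteinₚ s k = (Xₚ ^ₚ (s ∸ k)) *ₚ (oneMinusXₚ ^ₚ k)

bernsteinₚ-vanishesBelow : ∀ s k → VanishesBelow (s ∸ k) (bernsteinₚ s k)
bernsteinₚ-vanishesBelow s k = *ₚ-vanishesBelow (Xₚ ^ₚ (s ∸ k)) _ (Xₚ^ₚ-vanishesBelow (s ∸ k))

coeff-bernsteinₚ-lowest : ∀ s k → coeff (bernsteinₚ s k) (s ∸ k) ≡ 1ℤ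
coeff-bernsteinₚ-lowest s k =
  trans (coeff-*ₚ-lowest (Xₚ ^ₚ (s ∸ k)) _ (Xₚ^ₚ-vanishesBelow (s ∸ k)))
        (cong₂ _*_ (coeff-Xₚ^ₚ-self (s ∸ k)) (coeff₀-oneMinusXₚ^ₚ k))

module Unitriangular
  (N : ℕ) (π : ℕ → ℕ) (b : ℕ → ℕ → ℤ)
  (π-injective : ∀ {k k′} → k < N → k′ < N → π k ≡ π k′ → k ≡ k′)
  (b-below : ∀ {k j} → j < π k → b k j ≡ 0ℤ)
  (b-pivot : ∀ {k} → k < N → b k (π k) ≡ 1ℤ)
  where

  independent : ∀ (d : ℕ → ℤ) → (∀ j → ∑[ k < N ] d k * b k j ≡ 0ℤ) → ∀ {k} → k < N → d k ≡ 0ℤ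
  -- Strong induction on the pivot: at j = π k, the terms with a larger pivot vanish
  -- because b does, and those with a smaller pivot by the induction hypothesis.
  independent d ∑≡0 k<N = <-rec P vanish _ k<N refl
    where
    P : ℕ → Set
    P t = ∀ {k} → k < N → π k ≡ t → d k ≡ 0ℤ

    vanish : ∀ t → (∀ {t′} → t′ < t → P t′) → P t
    vanish _ ih {k} k<N refl = begin
      d k                            ≡⟨ sym (ℤ.*-identityʳ (d k)) ⟩
      d k * 1ℤ                       ≡⟨ cong (d k *_) (sym (b-pivot k<N)) ⟩
      d k * b k (π k)                ≡⟨ sym (∑<-single N k<N off-pivot) ⟩
      ∑[ k′ < N ] d k′ * b k′ (π k)  ≡⟨ ∑≡0 (π k) ⟩
      0ℤ                             ∎
      where
      off-pivot : ∀ {k′} → k′ < N → k′ ≢ k → d k′ * b k′ (π k) ≡ 0ℤ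
      off-pivot {k′} k′<N k′≢k with π k ℕ.<? π k′
      ... | yes below = trans (cong (d k′ *_) (b-below below)) (ℤ.*-zeroʳ (d k′))
      ... | no  ≮     = cong (_* b k′ (π k)) (ih (≤∧≢⇒< (≮⇒≥ ≮) (k′≢k ∘ π-injective k′<N k<N)) k′<N refl)

  injective : ∀ (d d′ : ℕ → ℤ) → (∀ j → ∑[ k < N ] d k * b k j ≡ ∑[ k < N ] d′ k * b k j) →
    ∀ {k} → k < N → d k ≡ d′ k
  injective d d′ same k<N = ℤ.i-j≡0⇒i≡j (d _) (d′ _) (independent (λ k → d k - d′ k) difference k<N)
    where
    difference : ∀ j → ∑[ k < N ] (d k - d′ k) * b k j ≡ 0ℤ
    difference j = begin
      ∑[ k < N ] (d k - d′ k) * b k j                         ≡⟨ ∑<-cong N (λ {k} _ → [y-z]x≈yx-zx (b k j) (d k) (d′ k)) ⟩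
      ∑[ k < N ] (d k * b k j - d′ k * b k j)                 ≡⟨ ∑<-distrib-- N _ _ ⟩
      ∑[ k < N ] d k * b k j - ∑[ k < N ] d′ k * b k j        ≡⟨ cong (_- _) (same j) ⟩
      ∑[ k < N ] d′ k * b k j - ∑[ k < N ] d′ k * b k j       ≡⟨ ℤ.+-inverseʳ (∑[ k < N ] d′ k * b k j) ⟩
      0ℤ                                                       ∎

bernstein-coefficients-unique : ∀ s (a a′ : ℕ → ℤ) →
  (∀ j → ∑[ k < suc s ] a k * coeff (bernsteinₚ s k) j ≡ ∑[ k < suc s ] a′ k * coeff (bernsteinₚ s k) j) →
  ∀ {k} → k ≤ s → a k ≡ a′ k
bernstein-coefficients-unique s a a′ same k≤s =
  Unitriangular.injective (suc s) (s ∸_) (coeff ∘ bernsteinₚ s)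
    (λ k<1+s k′<1+s → ∸-cancelˡ-≡ (s≤s⁻¹ k<1+s) (s≤s⁻¹ k′<1+s))
    (λ {k} → bernsteinₚ-vanishesBelow s k) (λ {k} _ → coeff-bernsteinₚ-lowest s k)
    a a′ same (s≤s k≤s)

∣p∩∁q∣≡∣p∣∸∣q∣ : ∀ {n} {p q : Subset n} → q ⊆ p → ∣ p ∩ ∁ q ∣ ≡ ∣ p ∣ ∸ ∣ q ∣
∣p∩∁q∣≡∣p∣∸∣q∣ {p = []}          {[]}          _   = refl
∣p∩∁q∣≡∣p∣∸∣q∣ {p = inside ∷ p}  {inside ∷ q}  q⊆p = ∣p∩∁q∣≡∣p∣∸∣q∣ (drop-∷-⊆ q⊆p)
∣p∩∁q∣≡∣p∣∸∣q∣ {p = inside ∷ p}  {outside ∷ q} q⊆p =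
  trans (cong suc (∣p∩∁q∣≡∣p∣∸∣q∣ (drop-∷-⊆ q⊆p))) (sym (+-∸-assoc 1 (p⊆q⇒∣p∣≤∣q∣ (drop-∷-⊆ q⊆p))))
∣p∩∁q∣≡∣p∣∸∣q∣ {p = outside ∷ p} {inside ∷ q}  q⊆p = contradiction (q⊆p here) λ ()
∣p∩∁q∣≡∣p∣∸∣q∣ {p = outside ∷ p} {outside ∷ q} q⊆p = ∣p∩∁q∣≡∣p∣∸∣q∣ (drop-∷-⊆ q⊆p)

subsetsOf-⊆ : ∀ {n} (S : Subset n) → All (_⊆ S) (subsetsOf S)
subsetsOf-⊆ S = all-filter (_⊆? S) (allSubsets _)

module _ {A : Set} (κ : A → ℕ) (w : A → ℕ) where

  -- Shaped so that fibreSum ∣_∣ (∣_∣ ∘ Obs G) (subsetsOf S) is obsSum G S by definition.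
  fibreSum : List A → ℕ → ℕ
  fibreSum L k = foldr (λ x acc → w x ℕ.+ acc) 0 (filter (λ x → κ x ℕ.≟ k) L)

  fibreSum-∷-≢ : ∀ x L {k} → κ x ≢ k → fibreSum (x ∷ L) k ≡ fibreSum L k
  fibreSum-∷-≢ x L {k} κx≢k rewrite dec-false (κ x ℕ.≟ k) κx≢k = refl

  fibreSum-∷-≡ : ∀ x L → fibreSum (x ∷ L) (κ x) ≡ w x ℕ.+ fibreSum L (κ x)
  fibreSum-∷-≡ x L rewrite dec-true (κ x ℕ.≟ κ x) refl = refl

  ∑-by-fibres : ∀ s (F : ℕ → ℤ) {L} → All (λ x → κ x ≤ s) L →
    ∑[ x ∈ L ] + w x * F (κ x) ≡ ∑[ k < suc s ] + fibreSum L k * F k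
  ∑-by-fibres s F []                 = sym (∑<-zero (suc s))
  ∑-by-fibres s F {x ∷ L} (κx≤s ∷ L≤s) = sym (begin
    ∑[ k < suc s ] + fibreSum (x ∷ L) k * F k
      ≡⟨ ∑<-update (suc s) {c = + w x * F (κ x)} (s≤s κx≤s)
                   (λ {k} _ k≢κx → cong (λ m → + m * F k) (fibreSum-∷-≢ x L (k≢κx ∘ sym)))
                   adds-at-κx ⟩
    + w x * F (κ x) + ∑[ k < suc s ] + fibreSum L k * F k
      ≡⟨ cong (_+_ (+ w x * F (κ x))) (sym (∑-by-fibres s F L≤s)) ⟩
    + w x * F (κ x) + ∑[ y ∈ L ] + w y * F (κ y)   ∎)
    where
    adds-at-κx : + fibreSum (x ∷ L) (κ x) * F (κ x) ≡ + w x * F (κ x) + + fibreSum L (κ x) * F (κ x)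
    adds-at-κx = begin
      + fibreSum (x ∷ L) (κ x) * F (κ x)                  ≡⟨ cong (λ m → + m * F (κ x)) (fibreSum-∷-≡ x L) ⟩
      + (w x ℕ.+ fibreSum L (κ x)) * F (κ x)              ≡⟨ cong (_* F (κ x)) (ℤ.pos-+ (w x) (fibreSum L (κ x))) ⟩
      (+ w x + + fibreSum L (κ x)) * F (κ x)              ≡⟨ ℤ.*-distribʳ-+ (F (κ x)) (+ w x) (+ fibreSum L (κ x)) ⟩
      + w x * F (κ x) + + fibreSum L (κ x) * F (κ x)      ∎

coeff-𝓔 : ∀ {n} (G : Graph n) (S : Subset n) j →
  coeff (𝓔 G S) j ≡ ∑[ k < suc ∣ S ∣ ] + obsSum G S k * coeff (bernsteinₚ ∣ S ∣ k) j
coeff-𝓔 {n} G S j = begin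
  coeff (𝓔 G S) j
    ≡⟨ coeff-sumₚ term (subsetsOf S) j ⟩
  ∑[ W ∈ subsetsOf S ] coeff (term W) j
    ≡⟨ ∑∈-congᴬ coeff-term (subsetsOf-⊆ S) ⟩
  ∑[ W ∈ subsetsOf S ] + ∣ Obs G W ∣ * coeff (bernsteinₚ ∣ S ∣ ∣ W ∣) j
    ≡⟨ ∑-by-fibres ∣_∣ (λ W → ∣ Obs G W ∣) ∣ S ∣ (λ k → coeff (bernsteinₚ ∣ S ∣ k) j)
                   (All.map p⊆q⇒∣p∣≤∣q∣ (subsetsOf-⊆ S)) ⟩
  ∑[ k < suc ∣ S ∣ ] + obsSum G S k * coeff (bernsteinₚ ∣ S ∣ k) j
    ∎
  where
  term : Subset n → Poly
  term W = scaleₚ (+ ∣ Obs G W ∣) ((Xₚ ^ₚ ∣ S ∩ ∁ W ∣) *ₚ (oneMinusXₚ ^ₚ ∣ W ∣))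

  coeff-term : ∀ {W} → W ⊆ S → coeff (term W) j ≡ + ∣ Obs G W ∣ * coeff (bernsteinₚ ∣ S ∣ ∣ W ∣) j
  coeff-term {W} W⊆S =
    trans (coeff-scaleₚ (+ ∣ Obs G W ∣) ((Xₚ ^ₚ ∣ S ∩ ∁ W ∣) *ₚ (oneMinusXₚ ^ₚ ∣ W ∣)) j)
          (cong (λ t → + ∣ Obs G W ∣ * coeff ((Xₚ ^ₚ t) *ₚ (oneMinusXₚ ^ₚ ∣ W ∣)) j) (∣p∩∁q∣≡∣p∣∸∣q∣ W⊆S))

theorem3p1 : {n n′ : ℕ} (G : Graph n) (G′ : Graph n′) (S : Subset n) (S′ : Subset n′) →
    ∣ S ∣ ≡ ∣ S′ ∣ →
    (𝓔 G S ≈ₚ 𝓔 G′ S′) ⇔ (∀ k → k ≤ ∣ S ∣ → obsSum G S k ≡ obsSum G′ S′ k)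
theorem3p1 G G′ S S′ ∣S∣≡∣S′∣ = mk⇔ to from
  where
  expansion′ : ∀ j → coeff (𝓔 G′ S′) j ≡ ∑[ k < suc ∣ S ∣ ] + obsSum G′ S′ k * coeff (bernsteinₚ ∣ S ∣ k) j
  expansion′ rewrite ∣S∣≡∣S′∣ = coeff-𝓔 G′ S′

  to : 𝓔 G S ≈ₚ 𝓔 G′ S′ → ∀ k → k ≤ ∣ S ∣ → obsSum G S k ≡ obsSum G′ S′ k
  to 𝓔≈𝓔′ k k≤s = ℤ.+-injective (bernstein-coefficients-unique ∣ S ∣ (λ k → + obsSum G S k) (λ k → + obsSum G′ S′ k)
    (λ j → trans (sym (coeff-𝓔 G S j)) (trans (𝓔≈𝓔′ j) (expansion′ j))) k≤s)

  from : (∀ k → k ≤ ∣ S ∣ → obsSum G S k ≡ obsSum G′ S′ k) → 𝓔 G S ≈ₚ 𝓔 G′ S′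
  from a≡a′ j = trans (coeff-𝓔 G S j)
    (trans (∑<-cong (suc ∣ S ∣) (λ {k} k<1+s → cong (λ a → + a * coeff (bernsteinₚ ∣ S ∣ k) j) (a≡a′ k (s≤s⁻¹ k<1+s))))
           (sym (expansion′ j)))
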